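{- Let $a_1,\ldots,a_n$ be nonnegative integers with $j$ entries equal to $0$, $k$ entries positive and even, and $l$ entries odd, $n=j+k+l$. If $j\ge1$ is odd, $k\ge2$ is even, and $l\in\{1,2\}$, then $RT(a_1,\ldots,a_n)$ is super edge-graceful.
   Context: For a finite simple graph $G$ with $p$ vertices and $q$ edges, $G$ is super edge-graceful if there is a bijection $f$ from $E(G)$ onto $\{0,\pm1,\ldots,\pm\frac{q-1}{2}\}$ when $q$ is odd, and onto $\{\pm1,\ldots,\pm\frac{q}{2}\}$ when $q$ is even, such that the induced vertex labeling $f^+(v)=\sum_{uv\in E(G)} f(uv)$ is a bijection from $V(G)$ onto $\{0,\pm1,\ldots,\pm\frac{p-1}{2}\}$ when $p$ is odd, and onto $\{\pm1,\ldots,\pm\frac{p}{2}\}$ when $p$ is even. For nonnegative integers $a_1,\ldots,a_n$, $RT(a_1,\ldots,a_n)$ is the rooted tree with root $v_0$, children $v_1,\ldots,v_n$ of $v_0$, where $v_i$ has exactly $a_i$ children, all of which are leaves. -}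

module Defs where

open import Data.Nat using (ℕ; zero; suc; _+_; _%_; _/_; _≡ᵇ_)
open import Data.Bool using (Bool; true; false; if_then_else_)
open import Data.Integer as ℤ using (ℤ; +_; ∣_∣)
open import Data.Fin using (Fin; toℕ)
open import Data.List using (List; []; _∷_; length; lookup; allFin; map; foldr)
open import Data.Nat.ListAction using (sum)
open import Data.Product using (_×_; _,_; Σ; ∃)
open import Relation.Binary.PropositionalEquality using (_≡_; _≢_)
open import Function.Definitions using (Injective)

-- Finite graphs, given by a vertex count p (vertices 0,…,p-1) and a list
-- of edges (pairs of vertex numbers).  Edges are indexed by Fin q where
-- q = length of the edge list.

record Graph : Set where
  constructor mkGraph
  field
    nV    : ℕ
    edges : List (ℕ × ℕ)

open Graph public

nE : Graph → ℕ
nE G = length (edges G)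

-- The label set {0,±1,…,±(m-1)/2} (m odd) or {±1,…,±m/2} (m even).
Labels : ℕ → ℤ → Set
Labels m x with m % 2
... | zero  = (x ≢ + 0) × (∣ x ∣ Data.Nat.≤ m / 2)
... | suc _ = ∣ x ∣ Data.Nat.≤ m / 2

BijOnto : ∀ {m} → (Fin m → ℤ) → (ℤ → Set) → Set
BijOnto {m} h S = Injective _≡_ _≡_ h × (∀ i → S (h i)) × (∀ x → S x → ∃ λ i → h i ≡ x)

incident : ℕ → ℕ × ℕ → Bool
incident v (a , b) = if v ≡ᵇ a then true else (v ≡ᵇ b)

sumℤ : List ℤ → ℤ
sumℤ = foldr ℤ._+_ (+ 0)

induced : (G : Graph) → (Fin (nE G) → ℤ) → Fin (nV G) → ℤ
induced G f v =
  sumℤ (map (λ e → if incident (toℕ v) (lookup (edges G) e) then f e else + 0)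
            (allFin (nE G)))

SuperEdgeGraceful : Graph → Set
SuperEdgeGraceful G =
  Σ (Fin (nE G) → ℤ) λ f →
    BijOnto f (Labels (nE G)) × BijOnto (induced G f) (Labels (nV G))

-- The rooted tree RT(a₁,…,aₙ).
-- Vertex 0 is the root v₀, vertices 1,…,n are v₁,…,vₙ, and vertices
-- n+1,…,n+Σaᵢ are the leaves (the aᵢ children of vᵢ, in consecutive blocks).

leafEdges : ℕ → ℕ → ℕ → List (ℕ × ℕ)
leafEdges c o zero    = []
leafEdges c o (suc a) = (c , o) ∷ leafEdges c (suc o) a

-- c = current child vertex, o = next free leaf vertex
build : ℕ → ℕ → List ℕ → List (ℕ × ℕ)
build c o []       = []
build c o (a ∷ as) = (0 , c) ∷ (leafEdges c o a Data.List.++ build (suc c) (o + a) as)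

RT : List ℕ → Graph
RT as = mkGraph (1 + length as + sum as) (build 1 (1 + length as) as)

isOdd : ℕ → Bool
isOdd x = x % 2 ≡ᵇ 1

countZero : List ℕ → ℕ
countZero []           = 0
countZero (zero ∷ as)  = suc (countZero as)
countZero (suc _ ∷ as) = countZero as

countPosEven : List ℕ → ℕ
countPosEven []           = 0
countPosEven (zero ∷ as)  = countPosEven as
countPosEven (suc x ∷ as) = if isOdd (suc x) then countPosEven as else suc (countPosEven as)

countOdd : List ℕ → ℕ
countOdd []       = 0
countOdd (x ∷ as) = if isOdd x then suc (countOdd as) else countOdd as

module Submission where

-- A labelling of RT is given child by child: vᵢ gets a block (r , L), r the label of v₀vᵢ
-- and L the labels of its leaf edges; then f⁺(v₀) = Σr, f⁺(vᵢ) = r + ΣL, and every leaf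
-- carries the label of its edge.  Since a labelling whose values permute the canonical label
-- list is a bijection onto the label set, it suffices to find blocks whose edge labels permute
-- 0,±1,…,±M and whose vertex labels permute ±1,…,±(M+1) (so q = 2M+1 and p = 2M+2).
--
-- Almost all labels are used in opposite pairs ±c: the leaves receive consecutive pairs
-- (which cancel in ΣL) and the root edges of the zero and the even children receive the
-- pairs ±(s+1), ±(s+2), ….  A scheme fixes the few remaining labels; the generator of blocks
-- is correct as soon as two finite permutation identities hold for the scheme
-- (scheme-graceful).  The theorem follows from one scheme for l = 1 and one for l = 2.

open import Defs
open import Data.Nat using (ℕ; _≤_; _%_)
open import Data.List using (List)
open import Data.Sum using (_⊎_)
open import Relation.Binary.PropositionalEquality using (_≡_)

open import Data.Nat using (zero; suc; _+_; _*_; _<_; z≤n; s≤s; _/_; _∸_; pred; _≡ᵇ_)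
import Data.Nat.Properties as ℕP
open import Data.Nat.DivMod using (m≡m%n+[m/n]*n; m%n<n; [m+kn]%n≡m%n; m*n%n≡0; m*n/n≡m; +-distrib-/)
open import Data.Nat.ListAction using (sum)
open import Data.Integer as ℤ using (ℤ; +_; -[1+_]; ∣_∣)
import Data.Integer.Properties as ℤP
open import Data.Bool using (Bool; true; false; if_then_else_; T)
open import Data.Unit using (tt)
open import Data.Fin using (Fin; toℕ) renaming (zero to fzero; suc to fsuc)
import Data.Fin.Properties as FinP
open import Data.List using ([]; _∷_; _++_; length; tabulate; zipWith; lookup)
import Data.List.Properties as ListP
open import Data.List.Membership.Propositional using (_∈_)
import Data.List.Membership.Propositional.Properties as ∈P
open import Data.List.Relation.Unary.Any using (here; there)
open import Data.List.Relation.Unary.All as All using (All; _∷_)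
import Data.List.Relation.Unary.All.Properties as AllP
open import Data.List.Relation.Unary.AllPairs using ([]; _∷_)
open import Data.List.Relation.Unary.Unique.Propositional using (Unique)
open import Data.List.Relation.Binary.Permutation.Propositional
  using (_↭_; prep; swap; ↭-refl; ↭-sym; ↭-trans; ↭-reflexive; ↭⇒↭ₛ; module PermutationReasoning)
import Data.List.Relation.Binary.Permutation.Propositional.Properties as ↭P
import Data.List.Relation.Binary.Permutation.Setoid.Properties as ↭ₛP
open import Data.Product using (_×_; _,_; ∃; proj₁; proj₂)
open import Data.Sum using (inj₁; inj₂)
open import Data.Empty using (⊥-elim)
open import Function using (id; _∘_)
open import Function.Definitions using (Injective)
open import Relation.Nullary using (yes; no)
open import Data.Nat.Solver using (module +-*-Solver)
open import Relation.Binary.PropositionalEquality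
  using (_≢_; refl; sym; trans; cong; cong₂; subst; setoid; module ≡-Reasoning)

pairs : ℕ → ℕ → List ℤ
pairs c zero    = []
pairs c (suc h) = + c ∷ ℤ.- (+ c) ∷ pairs (suc c) h

-- Opposite pairs cancel; this is why a child whose leaf labels are pairs has f⁺ = r.
sum-pairs : ∀ c h → sumℤ (pairs c h) ≡ + 0
sum-pairs c zero    = refl
sum-pairs c (suc h) rewrite sum-pairs (suc c) h | ℤP.+-identityʳ (ℤ.- (+ c)) = ℤP.+-inverseʳ (+ c)

length-pairs : ∀ c h → length (pairs c h) ≡ h + h
length-pairs c zero    = refl
length-pairs c (suc h) rewrite length-pairs (suc c) h | ℕP.+-suc h h = refl

pairs-++ : ∀ c h₁ h₂ → pairs c (h₁ + h₂) ≡ pairs c h₁ ++ pairs (c + h₁) h₂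
pairs-++ c zero     h₂ rewrite ℕP.+-identityʳ c = refl
pairs-++ c (suc h₁) h₂ rewrite pairs-++ (suc c) h₁ h₂ | ℕP.+-suc c h₁ = refl

pairs-snoc : ∀ c h → pairs c (suc h) ≡ pairs c h ++ (+ (c + h) ∷ ℤ.- (+ (c + h)) ∷ [])
pairs-snoc c h rewrite sym (pairs-++ c h 1) | ℕP.+-comm h 1 = refl

∈-pairs⁻ : ∀ {c h x} → x ∈ pairs c h → c ≤ ∣ x ∣ × ∣ x ∣ < c + h
∈-pairs⁻ {c} {suc h} (here refl) = ℕP.≤-refl , ℕP.m<m+n c (s≤s z≤n)
∈-pairs⁻ {c} {suc h} {x} (there (here refl)) rewrite ℤP.∣-i∣≡∣i∣ (+ c) = ℕP.≤-refl , ℕP.m<m+n c (s≤s z≤n)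
∈-pairs⁻ {c} {suc h} {x} (there (there x∈)) =
  let (lower , upper) = ∈-pairs⁻ x∈
  in ℕP.<⇒≤ lower , subst (∣ x ∣ <_) (sym (ℕP.+-suc c h)) upper

abs-cases : ∀ (x : ℤ) → x ≡ + ∣ x ∣ ⊎ x ≡ ℤ.- (+ ∣ x ∣)
abs-cases (+ n)    = inj₁ refl
abs-cases -[1+ n ] = inj₂ refl

∈-pairs⁺ : ∀ c h x → c ≤ ∣ x ∣ → ∣ x ∣ < c + h → x ∈ pairs c h
∈-pairs⁺ c zero    x lower upper rewrite ℕP.+-identityʳ c = ⊥-elim (ℕP.<-irrefl refl (ℕP.≤-trans upper lower))
∈-pairs⁺ c (suc h) x lower upper with ℕP.m≤n⇒m<n∨m≡n lower
... | inj₁ c<∣x∣ = there (there (∈-pairs⁺ (suc c) h x c<∣x∣ (subst (∣ x ∣ <_) (ℕP.+-suc c h) upper)))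
... | inj₂ refl with abs-cases x
...   | inj₁ x≡c  = here x≡c
...   | inj₂ x≡-c = there (here x≡-c)

≢-by-∣∣ : ∀ {x y : ℤ} → ∣ x ∣ < ∣ y ∣ → x ≢ y
≢-by-∣∣ lt refl = ℕP.<-irrefl refl lt

-- pairs c h has no repetitions when c ≥ 1 (so that +c ≠ -c).
unique-pairs : ∀ c h → 1 ≤ c → Unique (pairs c h)
unique-pairs c       zero    _   = []
unique-pairs (suc c) (suc h) _ =
  ((λ ()) ∷ All.map ≢-by-∣∣ larger) ∷ All.map ≢-by-∣∣ larger ∷ unique-pairs (suc (suc c)) h (s≤s z≤n)
  where
  larger : All (λ y → suc c < ∣ y ∣) (pairs (suc (suc c)) h)
  larger = All.tabulate (λ y∈ → proj₁ (∈-pairs⁻ y∈))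

tabulate-injective : ∀ {m} (h : Fin m → ℤ) → Unique (tabulate h) → Injective _≡_ _≡_ h
tabulate-injective h (_ ∷ _)      {fzero}  {fzero}  _  = refl
tabulate-injective h (h₀∉ ∷ _)    {fzero}  {fsuc j} eq = ⊥-elim (AllP.tabulate⁻ h₀∉ j eq)
tabulate-injective h (h₀∉ ∷ _)    {fsuc i} {fzero}  eq = ⊥-elim (AllP.tabulate⁻ h₀∉ i (sym eq))
tabulate-injective h (_ ∷ unique) {fsuc i} {fsuc j} eq = cong fsuc (tabulate-injective (h ∘ fsuc) unique eq)

↭⇒BijOnto : ∀ {m} (h : Fin m → ℤ) (C : List ℤ) (S : ℤ → Set) →
  Unique C → (∀ {x} → x ∈ C → S x) → (∀ {x} → S x → x ∈ C) →
  tabulate h ↭ C → BijOnto h S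
↭⇒BijOnto h C S unique sound complete h↭C =
  tabulate-injective h (↭ₛP.Unique-resp-↭ (setoid ℤ) (↭⇒↭ₛ (↭-sym h↭C)) unique) ,
  (λ i → sound (↭P.∈-resp-↭ h↭C (∈P.∈-tabulate⁺ i))) ,
  λ x Sx → let (i , hi≡x) = ∈P.∈-tabulate⁻ (↭P.∈-resp-↭ (↭-sym h↭C) (complete Sx)) in i , sym hi≡x

two-halves : ∀ n → n + n ≡ n * 2
two-halves n = trans (cong (λ k → n + k) (sym (ℕP.+-identityʳ n))) (ℕP.*-comm 2 n)

odd-%2 : ∀ M → suc (M + M) % 2 ≡ 1
odd-%2 M rewrite two-halves M = [m+kn]%n≡m%n 1 M 2

odd-/2 : ∀ M → suc (M + M) / 2 ≡ M
odd-/2 M rewrite two-halves M = trans (+-distrib-/ 1 (M * 2) {2} noCarry) (m*n/n≡m M 2)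
  where
  noCarry : 1 % 2 + (M * 2) % 2 < 2
  noCarry = subst (λ r → 1 + r < 2) (sym (m*n%n≡0 M 2)) (s≤s (s≤s z≤n))

even-%2 : ∀ M → (M + M) % 2 ≡ 0
even-%2 M rewrite two-halves M = m*n%n≡0 M 2

even-/2 : ∀ M → (M + M) / 2 ≡ M
even-/2 M rewrite two-halves M = m*n/n≡m M 2

Labels-odd : ∀ M x → Labels (suc (M + M)) x ≡ (∣ x ∣ ≤ M)
Labels-odd M x with suc (M + M) % 2 | odd-%2 M
... | .1 | refl = cong (∣ x ∣ ≤_) (odd-/2 M)

Labels-even : ∀ M x → Labels (M + M) x ≡ ((x ≢ + 0) × (∣ x ∣ ≤ M))
Labels-even M x with (M + M) % 2 | even-%2 M
... | .0 | refl = cong (λ d → (x ≢ + 0) × (∣ x ∣ ≤ d)) (even-/2 M)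

↭-zero-pairs⇒BijOnto : ∀ {m} M (h : Fin m → ℤ) → tabulate h ↭ + 0 ∷ pairs 1 M → BijOnto h (Labels m)
↭-zero-pairs⇒BijOnto {m} M h h↭ = ↭⇒BijOnto h (+ 0 ∷ pairs 1 M) (Labels m) unique sound complete h↭
  where
  m≡ : m ≡ suc (M + M)
  m≡ = trans (sym (ListP.length-tabulate h)) (trans (↭P.↭-length h↭) (cong suc (length-pairs 1 M)))
  toLabels : ∀ {x} → ∣ x ∣ ≤ M → Labels m x
  toLabels {x} le = subst (λ n → Labels n x) (sym m≡) (subst id (sym (Labels-odd M x)) le)
  fromLabels : ∀ {x} → Labels m x → ∣ x ∣ ≤ M
  fromLabels {x} Sx = subst id (Labels-odd M x) (subst (λ n → Labels n x) m≡ Sx)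
  unique : Unique (+ 0 ∷ pairs 1 M)
  unique = All.tabulate (λ y∈ → ≢-by-∣∣ (proj₁ (∈-pairs⁻ y∈))) ∷ unique-pairs 1 M (s≤s z≤n)
  sound : ∀ {x} → x ∈ + 0 ∷ pairs 1 M → Labels m x
  sound (here refl) = toLabels z≤n
  sound (there x∈)  = toLabels (ℕP.≤-pred (proj₂ (∈-pairs⁻ x∈)))
  complete : ∀ {x} → Labels m x → x ∈ + 0 ∷ pairs 1 M
  complete {+ zero}    _  = here refl
  complete {+ suc n}   Sx = there (∈-pairs⁺ 1 M (+ suc n) (s≤s z≤n) (s≤s (fromLabels Sx)))
  complete { -[1+ n ]} Sx = there (∈-pairs⁺ 1 M -[1+ n ] (s≤s z≤n) (s≤s (fromLabels Sx)))

↭-pairs⇒BijOnto : ∀ {m} M (h : Fin m → ℤ) → tabulate h ↭ pairs 1 M → BijOnto h (Labels m)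
↭-pairs⇒BijOnto {m} M h h↭ = ↭⇒BijOnto h (pairs 1 M) (Labels m) (unique-pairs 1 M (s≤s z≤n)) sound complete h↭
  where
  m≡ : m ≡ M + M
  m≡ = trans (sym (ListP.length-tabulate h)) (trans (↭P.↭-length h↭) (length-pairs 1 M))
  sound : ∀ {x} → x ∈ pairs 1 M → Labels m x
  sound {x} x∈ = subst (λ n → Labels n x) (sym m≡) (subst id (sym (Labels-even M x))
    ((λ x≡0 → ℕP.<-irrefl (cong ∣_∣ (sym x≡0)) (proj₁ (∈-pairs⁻ x∈))) , ℕP.≤-pred (proj₂ (∈-pairs⁻ x∈))))
  complete : ∀ {x} → Labels m x → x ∈ pairs 1 M
  complete {x} Sx with subst id (Labels-even M x) (subst (λ n → Labels n x) m≡ Sx)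
  ... | x≢0 , ∣x∣≤M = ∈-pairs⁺ 1 M x (nonzero x x≢0) (s≤s ∣x∣≤M)
    where
    nonzero : ∀ x → x ≢ + 0 → 1 ≤ ∣ x ∣
    nonzero (+ zero)  x≢0 = ⊥-elim (x≢0 refl)
    nonzero (+ suc n) _   = s≤s z≤n
    nonzero -[1+ n ]  _   = s≤s z≤n

nth : List ℤ → ℕ → ℤ
nth []       _       = + 0
nth (x ∷ xs) zero    = x
nth (x ∷ xs) (suc i) = nth xs i

nth-tabulate : ∀ (ls : List ℤ) m → length ls ≡ m → tabulate {n = m} (nth ls ∘ toℕ) ≡ ls
nth-tabulate []       zero    _  = refl
nth-tabulate (x ∷ ls) (suc m) eq = cong (x ∷_) (nth-tabulate ls m (ℕP.suc-injective eq))

nth-++ˡ : ∀ (L M : List ℤ) {t} → t < length L → nth (L ++ M) t ≡ nth L t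
nth-++ˡ (x ∷ L) M {zero}  _         = refl
nth-++ˡ (x ∷ L) M {suc t} (s≤s t<) = nth-++ˡ L M t<

nth-++ʳ : ∀ (L M : List ℤ) t → nth (L ++ M) (length L + t) ≡ nth M t
nth-++ʳ []      M t = refl
nth-++ʳ (x ∷ L) M t = nth-++ʳ L M t

contribution : ℕ → ℕ × ℕ → ℤ → ℤ
contribution w ed l = if incident w ed then l else + 0

weight : ℕ → List (ℕ × ℕ) → List ℤ → ℤ
weight w es ls = sumℤ (zipWith (contribution w) es ls)

induced≡weight : ∀ G (ls : List ℤ) → length ls ≡ nE G → ∀ v →
  induced G (nth ls ∘ toℕ) v ≡ weight (toℕ v) (edges G) ls
induced≡weight G ls eq v = cong sumℤ (trans (ListP.map-tabulate id _) (tabulate-zip (edges G) ls eq))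
  where
  tabulate-zip : ∀ (es : List (ℕ × ℕ)) (ls : List ℤ) → length ls ≡ length es →
    tabulate (λ e → contribution (toℕ v) (lookup es e) (nth ls (toℕ e))) ≡ zipWith (contribution (toℕ v)) es ls
  tabulate-zip []       []       _  = refl
  tabulate-zip (e ∷ es) (l ∷ ls) eq = cong (contribution (toℕ v) e l ∷_) (tabulate-zip es ls (ℕP.suc-injective eq))

≡ᵇ-refl : ∀ n → (n ≡ᵇ n) ≡ true
≡ᵇ-refl zero    = refl
≡ᵇ-refl (suc n) = ≡ᵇ-refl n

≢⇒≡ᵇ-false : ∀ {m n} → m ≢ n → (m ≡ᵇ n) ≡ false
≢⇒≡ᵇ-false {zero}  {zero}  m≢n = ⊥-elim (m≢n refl)
≢⇒≡ᵇ-false {zero}  {suc n} _   = refl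
≢⇒≡ᵇ-false {suc m} {zero}  _   = refl
≢⇒≡ᵇ-false {suc m} {suc n} m≢n = ≢⇒≡ᵇ-false (m≢n ∘ cong suc)

contribution-fst : ∀ w b l → contribution w (w , b) l ≡ l
contribution-fst w b l rewrite ≡ᵇ-refl w = refl

contribution-snd : ∀ {w a} l → w ≢ a → contribution w (a , w) l ≡ l
contribution-snd {w} l w≢a rewrite ≢⇒≡ᵇ-false w≢a | ≡ᵇ-refl w = refl

contribution-none : ∀ {w a b} l → w ≢ a → w ≢ b → contribution w (a , b) l ≡ + 0
contribution-none l w≢a w≢b rewrite ≢⇒≡ᵇ-false w≢a | ≢⇒≡ᵇ-false w≢b = refl

sumℤ-++ : ∀ xs ys → sumℤ (xs ++ ys) ≡ sumℤ xs ℤ.+ sumℤ ys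
sumℤ-++ []       ys = sym (ℤP.+-identityˡ _)
sumℤ-++ (x ∷ xs) ys rewrite sumℤ-++ xs ys = sym (ℤP.+-assoc x _ _)

sumℤ-↭ : ∀ {xs ys} → xs ↭ ys → sumℤ xs ≡ sumℤ ys
sumℤ-↭ p = ↭ₛP.foldr-commMonoid (setoid ℤ) ℤP.+-0-isCommutativeMonoid (↭⇒↭ₛ p)

weight-++ : ∀ w (es₁ es₂ : List (ℕ × ℕ)) (ls₁ ls₂ : List ℤ) → length es₁ ≡ length ls₁ →
  weight w (es₁ ++ es₂) (ls₁ ++ ls₂) ≡ weight w es₁ ls₁ ℤ.+ weight w es₂ ls₂
weight-++ w es₁ es₂ ls₁ ls₂ eq =
  trans (cong sumℤ (zip-++ es₁ ls₁ eq)) (sumℤ-++ (zipWith (contribution w) es₁ ls₁) _)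
  where
  zip-++ : ∀ (es₁ : List (ℕ × ℕ)) ls₁ → length es₁ ≡ length ls₁ →
    zipWith (contribution w) (es₁ ++ es₂) (ls₁ ++ ls₂) ≡
    zipWith (contribution w) es₁ ls₁ ++ zipWith (contribution w) es₂ ls₂
  zip-++ []        []        _  = refl
  zip-++ (e ∷ es₁) (l ∷ ls₁) eq = cong (contribution w e l ∷_) (zip-++ es₁ ls₁ (ℕP.suc-injective eq))

Outside : ℕ → ℕ → ℕ → Set
Outside w o n = w < o ⊎ o + n ≤ w

outside⇒≢ : ∀ {w o n} → Outside w o (suc n) → w ≢ o
outside⇒≢ (inj₁ w<o) refl = ℕP.<-irrefl refl w<o
outside⇒≢ {w} {n = n} (inj₂ o+n<w) refl = ℕP.<-irrefl refl (ℕP.<-≤-trans (ℕP.m<m+n w (s≤s z≤n)) o+n<w)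

outside-suc : ∀ {w o n} → Outside w o (suc n) → Outside w (suc o) n
outside-suc (inj₁ w<o) = inj₁ (ℕP.m≤n⇒m≤1+n w<o)
outside-suc {w} {o} {n} (inj₂ le) = inj₂ (subst (_≤ w) (ℕP.+-suc o n) le)

length-leafEdges : ∀ c o n → length (leafEdges c o n) ≡ n
length-leafEdges c o zero    = refl
length-leafEdges c o (suc n) = cong suc (length-leafEdges c (suc o) n)

weight-leaves-child : ∀ c o (L : List ℤ) → weight c (leafEdges c o (length L)) L ≡ sumℤ L
weight-leaves-child c o []      = refl
weight-leaves-child c o (l ∷ L) rewrite contribution-fst c o l | weight-leaves-child c (suc o) L = refl

weight-leaves-outside : ∀ {w c} o (L : List ℤ) → w ≢ c → Outside w o (length L) →
  weight w (leafEdges c o (length L)) L ≡ + 0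
weight-leaves-outside o []      _   _   = refl
weight-leaves-outside o (l ∷ L) w≢c out
  rewrite contribution-none l w≢c (outside⇒≢ out) | weight-leaves-outside (suc o) L w≢c (outside-suc out) = refl

weight-leaves-leaf : ∀ {c} o (L : List ℤ) t → o + t ≢ c → t < length L →
  weight (o + t) (leafEdges c o (length L)) L ≡ nth L t
weight-leaves-leaf o (l ∷ L) zero o≢c _
  rewrite ℕP.+-identityʳ o | contribution-snd l o≢c | weight-leaves-outside (suc o) L o≢c (inj₁ ℕP.≤-refl) =
  ℤP.+-identityʳ l
weight-leaves-leaf o (l ∷ L) (suc t) o+t≢c (s≤s t<)
  rewrite contribution-none l o+t≢c (ℕP.m+1+n≢m o) | ℕP.+-suc o t | weight-leaves-leaf (suc o) L t o+t≢c t< =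
  ℤP.+-identityˡ _

-- A block labelling: every child gets the label r of its root edge and the labels L of
-- its leaf edges.
Block : Set
Block = ℤ × List ℤ

shape : List Block → List ℕ
shape []             = []
shape ((r , L) ∷ bs) = length L ∷ shape bs

-- the edge labels in the edge order of RT
lab : List Block → List ℤ
lab []             = []
lab ((r , L) ∷ bs) = r ∷ (L ++ lab bs)

roots : List Block → List ℤ
roots []             = []
roots ((r , L) ∷ bs) = r ∷ roots bs

leaves : List Block → List ℤ
leaves []             = []
leaves ((r , L) ∷ bs) = L ++ leaves bs

childLabels : List Block → List ℤ
childLabels []             = []
childLabels ((r , L) ∷ bs) = (r ℤ.+ sumℤ L) ∷ childLabels bs

vertexLabels : List Block → List ℤ
vertexLabels bs = sumℤ (roots bs) ∷ (childLabels bs ++ leaves bs)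

weight-block : ∀ w c o r (L : List ℤ) bs →
  weight w (build c o (shape ((r , L) ∷ bs))) (lab ((r , L) ∷ bs)) ≡
  contribution w (0 , c) r ℤ.+
    (weight w (leafEdges c o (length L)) L ℤ.+ weight w (build (suc c) (o + length L) (shape bs)) (lab bs))
weight-block w c o r L bs = cong (λ z → contribution w (0 , c) r ℤ.+ z)
  (weight-++ w (leafEdges c o (length L)) _ L (lab bs) (length-leafEdges c o (length L)))

weight-skip : ∀ {w c o r} {L : List ℤ} bs → w ≢ 0 → w ≢ c → Outside w o (length L) →
  weight w (build c o (shape ((r , L) ∷ bs))) (lab ((r , L) ∷ bs)) ≡ weight w (build (suc c) (o + length L) (shape bs)) (lab bs)
weight-skip {w} {c} {o} {r} {L} bs w≢0 w≢c out
  rewrite weight-block w c o r L bs | contribution-none r w≢0 w≢c | weight-leaves-outside o L w≢c out =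
  trans (ℤP.+-identityˡ _) (ℤP.+-identityˡ _)

weight-build-outside : ∀ {w} c o bs → w ≢ 0 → Outside w c (length bs) → w < o →
  weight w (build c o (shape bs)) (lab bs) ≡ + 0
weight-build-outside c o []             _   _   _   = refl
weight-build-outside c o ((r , L) ∷ bs) w≢0 out w<o =
  trans (weight-skip {r = r} {L} bs w≢0 (outside⇒≢ out) (inj₁ w<o))
        (weight-build-outside (suc c) (o + length L) bs w≢0 (outside-suc out) (ℕP.≤-trans w<o (ℕP.m≤m+n o (length L))))

weight-build-root : ∀ c o bs → 1 ≤ c → 1 ≤ o → weight 0 (build c o (shape bs)) (lab bs) ≡ sumℤ (roots bs)
weight-build-root c o []             _   _   = refl
weight-build-root c o ((r , L) ∷ bs) 1≤c 1≤o
  rewrite weight-block 0 c o r L bs | contribution-fst 0 c r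
        | weight-leaves-outside o L (λ 0≡c → ℕP.<-irrefl 0≡c 1≤c) (inj₁ 1≤o)
        | weight-build-root (suc c) (o + length L) bs (s≤s z≤n) (ℕP.≤-trans 1≤o (ℕP.m≤m+n o (length L))) =
  cong (λ z → r ℤ.+ z) (ℤP.+-identityˡ _)

child<leaf : ∀ {c o n} → c + suc n ≤ o → c < o
child<leaf {c} le = ℕP.<-≤-trans (ℕP.m<m+n c (s≤s z≤n)) le

leaf≢child : ∀ {c o n} x → c + suc n ≤ o → o + x ≢ c
leaf≢child {o = o} x le o+x≡c = ℕP.<-irrefl (sym o+x≡c) (ℕP.<-≤-trans (child<leaf le) (ℕP.m≤m+n o x))

leaf≢root : ∀ {c o n} x → 1 ≤ c → c + suc n ≤ o → o + x ≢ 0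
leaf≢root {o = o} x 1≤c le o+x≡0 =
  ℕP.<-irrefl (sym o+x≡0) (ℕP.<-≤-trans (ℕP.<-trans 1≤c (child<leaf le)) (ℕP.m≤m+n o x))

-- the invariant "children c, …, c+|bs|-1 precede the first leaf o" passed to the tail
next-child : ∀ {c o n} m → c + suc n ≤ o → suc c + n ≤ o + m
next-child {c} {o} {n} m le = ℕP.≤-trans (subst (_≤ o) (ℕP.+-suc c n) le) (ℕP.m≤m+n o m)

weight-build-child : ∀ c o bs i → 1 ≤ c → c + length bs ≤ o → i < length bs →
  weight (c + i) (build c o (shape bs)) (lab bs) ≡ nth (childLabels bs) i
weight-build-child c o ((r , L) ∷ bs) zero 1≤c le _
  rewrite ℕP.+-identityʳ c | weight-block c c o r L bs
        | contribution-snd r (λ c≡0 → ℕP.<-irrefl (sym c≡0) 1≤c) | weight-leaves-child c o L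
        | weight-build-outside (suc c) (o + length L) bs (λ c≡0 → ℕP.<-irrefl (sym c≡0) 1≤c) (inj₁ ℕP.≤-refl)
            (ℕP.<-≤-trans (child<leaf le) (ℕP.m≤m+n o (length L))) =
  cong (λ z → r ℤ.+ z) (ℤP.+-identityʳ _)
weight-build-child c o ((r , L) ∷ bs) (suc i) 1≤c le (s≤s i<) = begin
  weight (c + suc i) (build c o (shape ((r , L) ∷ bs))) (lab ((r , L) ∷ bs))
    ≡⟨ weight-skip {r = r} {L} bs (ℕP.m+1+n≢0 c) (ℕP.m+1+n≢m c)
         (inj₁ (ℕP.<-≤-trans (ℕP.+-monoʳ-< c (s≤s i<)) le)) ⟩
  weight (c + suc i) (build (suc c) (o + length L) (shape bs)) (lab bs)
    ≡⟨ cong (λ w → weight w (build (suc c) (o + length L) (shape bs)) (lab bs)) (ℕP.+-suc c i) ⟩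
  weight (suc c + i) (build (suc c) (o + length L) (shape bs)) (lab bs)
    ≡⟨ weight-build-child (suc c) (o + length L) bs i (s≤s z≤n) (next-child (length L) le) i< ⟩
  nth (childLabels bs) i ∎
  where open ≡-Reasoning

weight-build-leaf : ∀ c o bs t → 1 ≤ c → c + length bs ≤ o → t < length (leaves bs) →
  weight (o + t) (build c o (shape bs)) (lab bs) ≡ nth (leaves bs) t
weight-build-leaf c o ((r , L) ∷ bs) t 1≤c le t< with t ℕP.<? length L
... | yes t<L
  rewrite weight-block (o + t) c o r L bs
        | contribution-none r (leaf≢root t 1≤c le) (leaf≢child t le)
        | weight-leaves-leaf o L t (leaf≢child t le) t<L
        | weight-build-outside (suc c) (o + length L) bs (leaf≢root t 1≤c le) (inj₂ (next-child t le)) (ℕP.+-monoʳ-< o t<L)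
        | nth-++ˡ L (leaves bs) t<L =
  trans (ℤP.+-identityˡ _) (ℤP.+-identityʳ _)
... | no t≮L with t ∸ length L | ℕP.m+[n∸m]≡n (ℕP.≮⇒≥ t≮L)
...   | t' | refl = begin
  weight (o + (length L + t')) (build c o (shape ((r , L) ∷ bs))) (lab ((r , L) ∷ bs))
    ≡⟨ weight-skip {r = r} {L} bs (leaf≢root _ 1≤c le) (leaf≢child _ le)
         (inj₂ (ℕP.+-monoʳ-≤ o (ℕP.m≤m+n (length L) t'))) ⟩
  weight (o + (length L + t')) (build (suc c) (o + length L) (shape bs)) (lab bs)
    ≡⟨ cong (λ w → weight w (build (suc c) (o + length L) (shape bs)) (lab bs)) (sym (ℕP.+-assoc o (length L) t')) ⟩
  weight (o + length L + t') (build (suc c) (o + length L) (shape bs)) (lab bs)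
    ≡⟨ weight-build-leaf (suc c) (o + length L) bs t' (s≤s z≤n) (next-child (length L) le)
         (ℕP.+-cancelˡ-< (length L) t' _ (subst (length L + t' <_) (ListP.length-++ L) t<)) ⟩
  nth (leaves bs) t'
    ≡⟨ sym (nth-++ʳ L (leaves bs) t') ⟩
  nth (L ++ leaves bs) (length L + t') ∎
  where open ≡-Reasoning

length-shape : ∀ bs → length (shape bs) ≡ length bs
length-shape []       = refl
length-shape (_ ∷ bs) = cong suc (length-shape bs)

length-childLabels : ∀ bs → length (childLabels bs) ≡ length bs
length-childLabels []       = refl
length-childLabels (_ ∷ bs) = cong suc (length-childLabels bs)

length-leaves : ∀ bs → length (leaves bs) ≡ sum (shape bs)
length-leaves []             = refl
length-leaves ((r , L) ∷ bs) = trans (ListP.length-++ L) (cong (λ n → length L + n) (length-leaves bs))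

length-lab : ∀ c o bs → length (lab bs) ≡ length (build c o (shape bs))
length-lab c o []             = refl
length-lab c o ((r , L) ∷ bs) = cong suc (begin
  length (L ++ lab bs)
    ≡⟨ ListP.length-++ L ⟩
  length L + length (lab bs)
    ≡⟨ cong₂ _+_ (sym (length-leafEdges c o (length L))) (length-lab (suc c) (o + length L) bs) ⟩
  length (leafEdges c o (length L)) + length (build (suc c) (o + length L) (shape bs))
    ≡⟨ sym (ListP.length-++ (leafEdges c o (length L))) ⟩
  length (leafEdges c o (length L) ++ build (suc c) (o + length L) (shape bs)) ∎)
  where open ≡-Reasoning

lab-↭ : ∀ bs → lab bs ↭ roots bs ++ leaves bs
lab-↭ []             = ↭-refl
lab-↭ ((r , L) ∷ bs) = prep r (↭-trans (↭P.++⁺ˡ L (lab-↭ bs)) (↭P.shifts L (roots bs)))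

weight-build : ∀ bs w → w < length (vertexLabels bs) →
  weight w (build 1 (suc (length (shape bs))) (shape bs)) (lab bs) ≡ nth (vertexLabels bs) w
weight-build bs w w< rewrite length-shape bs = vertex w w<
  where
  lengths : length (childLabels bs ++ leaves bs) ≡ length bs + length (leaves bs)
  lengths = trans (ListP.length-++ (childLabels bs)) (cong (_+ length (leaves bs)) (length-childLabels bs))
  vertex : ∀ w → w < length (vertexLabels bs) →
    weight w (build 1 (suc (length bs)) (shape bs)) (lab bs) ≡ nth (vertexLabels bs) w
  vertex zero    _ = weight-build-root 1 (suc (length bs)) bs (s≤s z≤n) (s≤s z≤n)
  vertex (suc w) (s≤s w<) with w ℕP.<? length bs
  ... | yes w<bs = begin
    weight (suc w) (build 1 (suc (length bs)) (shape bs)) (lab bs)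
      ≡⟨ weight-build-child 1 (suc (length bs)) bs w (s≤s z≤n) ℕP.≤-refl w<bs ⟩
    nth (childLabels bs) w
      ≡⟨ sym (nth-++ˡ (childLabels bs) (leaves bs) (subst (w <_) (sym (length-childLabels bs)) w<bs)) ⟩
    nth (childLabels bs ++ leaves bs) w ∎
    where open ≡-Reasoning
  ... | no w≮bs with w ∸ length bs | ℕP.m+[n∸m]≡n (ℕP.≮⇒≥ w≮bs)
  ...   | t | refl = begin
    weight (suc (length bs + t)) (build 1 (suc (length bs)) (shape bs)) (lab bs)
      ≡⟨ weight-build-leaf 1 (suc (length bs)) bs t (s≤s z≤n) ℕP.≤-refl
           (ℕP.+-cancelˡ-< (length bs) t _ (subst (length bs + t <_) lengths w<)) ⟩
    nth (leaves bs) t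
      ≡⟨ sym (nth-++ʳ (childLabels bs) (leaves bs) t) ⟩
    nth (childLabels bs ++ leaves bs) (length (childLabels bs) + t)
      ≡⟨ cong (λ n → nth (childLabels bs ++ leaves bs) (n + t)) (length-childLabels bs) ⟩
    nth (childLabels bs ++ leaves bs) (length bs + t) ∎
    where open ≡-Reasoning

blocks-graceful : ∀ M bs → lab bs ↭ + 0 ∷ pairs 1 M → vertexLabels bs ↭ pairs 1 (suc M) →
  SuperEdgeGraceful (RT (shape bs))
blocks-graceful M bs lab↭ vertex↭ =
  f , ↭-zero-pairs⇒BijOnto M f values↭ , ↭-pairs⇒BijOnto (suc M) (induced G f) induced↭
  where
  G = RT (shape bs)
  f : Fin (nE G) → ℤ
  f = nth (lab bs) ∘ toℕ
  lengthE : length (lab bs) ≡ nE G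
  lengthE = length-lab 1 (suc (length (shape bs))) bs
  lengthV : length (vertexLabels bs) ≡ nV G
  lengthV = cong suc (trans (ListP.length-++ (childLabels bs))
              (cong₂ _+_ (trans (length-childLabels bs) (sym (length-shape bs))) (length-leaves bs)))
  values↭ : tabulate f ↭ + 0 ∷ pairs 1 M
  values↭ = subst (_↭ + 0 ∷ pairs 1 M) (sym (nth-tabulate (lab bs) (nE G) lengthE)) lab↭
  induced≡ : tabulate (induced G f) ≡ vertexLabels bs
  induced≡ = trans (ListP.tabulate-cong (λ v → trans (induced≡weight G (lab bs) lengthE v)
                                                     (weight-build bs (toℕ v) (subst (toℕ v <_) (sym lengthV) (FinP.toℕ<n v)))))
                   (nth-tabulate (vertexLabels bs) (nV G) lengthV)
  induced↭ : tabulate (induced G f) ↭ pairs 1 (suc M)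
  induced↭ = subst (_↭ pairs 1 (suc M)) (sym induced≡) vertex↭

-- A scheme fixes the few labels of the construction that are not part of an opposite pair.
record Scheme : Set where
  field
    small     : ℕ        -- magnitudes 1, …, small are placed by hand
    first₁ first₂ : ℤ    -- two leaf labels of the first positive even child (its root edge gets 0)
    regular₁ regular₂ : ℤ  -- the first two root-edge labels of the other zero/even children
    oddRoot oddLeaf : ℕ → ℤ  -- root-edge label and one leaf label of the i-th odd child

open Scheme

alternating : ℕ → ℕ → ℤ
alternating b zero          = + b
alternating b (suc zero)    = ℤ.- (+ b)
alternating b (suc (suc t)) = alternating (suc b) t

-- the root-edge label of the t-th child with aᵢ = 0 or aᵢ even, other than the first even one
regular : Scheme → ℕ → ℤ
regular S zero          = regular₁ S
regular S (suc zero)    = regular₂ S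
regular S (suc (suc t)) = alternating (suc (small S)) t

run : (ℕ → ℤ) → ℕ → ℕ → List ℤ
run f t zero    = []
run f t (suc n) = f t ∷ run f (suc t) n

run-shift : ∀ f t n → run f (suc t) n ≡ run (f ∘ suc) t n
run-shift f t zero    = refl
run-shift f t (suc n) = cong (f (suc t) ∷_) (run-shift f (suc t) n)

run-alternating : ∀ b Y → run (alternating b) 0 (Y + Y) ≡ pairs b Y
run-alternating b zero    = refl
run-alternating b (suc Y)
  rewrite ℕP.+-suc Y Y | run-shift (alternating b) 1 (Y + Y) | run-shift (alternating b ∘ suc) 0 (Y + Y)
        | run-alternating (suc b) Y = refl

run-regular : ∀ S Y → run (regular S) 0 (suc (suc (Y + Y))) ≡ regular₁ S ∷ regular₂ S ∷ pairs (suc (small S)) Y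
run-regular S Y
  rewrite run-shift (regular S) 1 (Y + Y) | run-shift (regular S ∘ suc) 0 (Y + Y)
        | run-alternating (suc (small S)) Y = refl

-- The block generator.  `seen` records whether the first positive even child has been
-- handled, o counts the odd children so far, t the regular labels used so far, and c is the
-- magnitude of the next free leaf pair.  A child with aᵢ = 2h+1 gets one scheme leaf label and
-- h leaf pairs, a later even child aᵢ = 2h gets h pairs, and the first even child 2h gets two
-- scheme labels and h-1 pairs.
blocks : Scheme → Bool → ℕ → ℕ → ℕ → List ℕ → List Block
blocks S seen o t c []            = []
blocks S seen o t c (zero ∷ as)   = (regular S t , []) ∷ blocks S seen o (suc t) c as
blocks S seen o t c (suc x ∷ as)  =
  if isOdd (suc x)
  then (oddRoot S o , oddLeaf S o ∷ pairs c (suc x / 2)) ∷ blocks S seen (suc o) t (c + suc x / 2) as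
  else (if seen
        then (regular S t , pairs c (suc x / 2)) ∷ blocks S true o (suc t) (c + suc x / 2) as
        else (+ 0 , first₁ S ∷ first₂ S ∷ pairs c (pred (suc x / 2))) ∷ blocks S true o t (c + pred (suc x / 2)) as)

regularCount : Bool → List ℕ → ℕ
regularCount seen []           = 0
regularCount seen (zero ∷ as)  = suc (regularCount seen as)
regularCount seen (suc x ∷ as) =
  if isOdd (suc x) then regularCount seen as
  else (if seen then suc (regularCount true as) else regularCount true as)

pairCount : Bool → List ℕ → ℕ
pairCount seen []           = 0
pairCount seen (zero ∷ as)  = pairCount seen as
pairCount seen (suc x ∷ as) =
  if isOdd (suc x) then suc x / 2 + pairCount seen as
  else (if seen then suc x / 2 + pairCount true as else pred (suc x / 2) + pairCount true as)

-- the labels contributed by the first positive even child, if it is still to come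
pending : List ℤ → Bool → ℕ → List ℤ
pending xs true  _       = []
pending xs false zero    = []
pending xs false (suc _) = xs

insert-end : ∀ {X : List ℤ} x A S → X ↭ A ++ S → x ∷ X ↭ A ++ (x ∷ S)
insert-end x A S p = ↭-trans (prep x p) (↭-sym (↭P.shift x A S))

insert-middle : ∀ {X : List ℤ} x A B S → X ↭ (A ++ B) ++ S → x ∷ X ↭ (A ++ (x ∷ B)) ++ S
insert-middle x A B S p = ↭-trans (prep x p) (↭-sym (↭P.++⁺ʳ S (↭P.shift x A B)))

insert-pairs : ∀ {X : List ℤ} P A P' → X ↭ A ++ P' → P ++ X ↭ A ++ (P ++ P')
insert-pairs P A P' p = ↭-trans (↭P.++⁺ˡ P p) (↭P.shifts P A)

isOdd⇒%2 : ∀ n → isOdd n ≡ true → n % 2 ≡ 1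
isOdd⇒%2 n eq = ℕP.≡ᵇ⇒≡ (n % 2) 1 (subst T (sym eq) tt)

¬isOdd⇒%2 : ∀ n → isOdd n ≡ false → n % 2 ≡ 0
¬isOdd⇒%2 n eq with n % 2 | m%n<n n 2
... | zero         | _             = refl
... | suc zero     | _ with () ← eq
... | suc (suc _)  | s≤s (s≤s ())

halves : ∀ n → n ≡ n % 2 + (n / 2 + n / 2)
halves n = trans (m≡m%n+[m/n]*n n 2) (cong (λ k → n % 2 + k) (sym (two-halves (n / 2))))

odd-halves : ∀ n → isOdd n ≡ true → n ≡ suc (n / 2 + n / 2)
odd-halves n odd = trans (halves n) (cong (λ r → r + (n / 2 + n / 2)) (isOdd⇒%2 n odd))

even-halves : ∀ n → isOdd n ≡ false → n ≡ n / 2 + n / 2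
even-halves n even = trans (halves n) (cong (λ r → r + (n / 2 + n / 2)) (¬isOdd⇒%2 n even))

shape-blocks : ∀ S seen o t c as → shape (blocks S seen o t c as) ≡ as
shape-blocks S seen o t c []           = refl
shape-blocks S seen o t c (zero ∷ as)  = cong (0 ∷_) (shape-blocks S seen o (suc t) c as)
shape-blocks S seen o t c (suc x ∷ as) with isOdd (suc x) in odd
... | true = cong₂ _∷_ (trans (cong suc (length-pairs c (suc x / 2)))
                              (sym (odd-halves (suc x) odd)))
                       (shape-blocks S seen (suc o) t _ as)
... | false with seen
...   | true  = cong₂ _∷_ (trans (length-pairs c (suc x / 2))
                                 (sym (even-halves (suc x) odd)))
                          (shape-blocks S true o (suc t) _ as)
...   | false = cong₂ _∷_ (trans (cong (suc ∘ suc) (length-pairs c (pred (suc x / 2))))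
                                 (first-length (suc x / 2) (even-halves (suc x) odd)))
                          (shape-blocks S true o t _ as)
  where
  first-length : ∀ h → suc x ≡ h + h → suc (suc (pred h + pred h)) ≡ suc x
  first-length (suc h) eq = trans (cong suc (sym (ℕP.+-suc h h))) (sym eq)

roots-blocks : ∀ S seen o t c as →
  roots (blocks S seen o t c as) ↭
    (pending (+ 0 ∷ []) seen (countPosEven as) ++ run (oddRoot S) o (countOdd as)) ++ run (regular S) t (regularCount seen as)
roots-blocks S true  o t c [] = ↭-refl
roots-blocks S false o t c [] = ↭-refl
roots-blocks S seen o t c (zero ∷ as) = insert-end (regular S t) _ _ (roots-blocks S seen o (suc t) c as)
roots-blocks S seen o t c (suc x ∷ as) with isOdd (suc x)
... | true = insert-middle (oddRoot S o) (pending (+ 0 ∷ []) seen (countPosEven as)) _ _ (roots-blocks S seen (suc o) t _ as)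
... | false with seen
...   | true  = insert-end (regular S t) _ _ (roots-blocks S true o (suc t) _ as)
...   | false = prep (+ 0) (roots-blocks S true o t _ as)

leaves-blocks : ∀ S seen o t c as →
  leaves (blocks S seen o t c as) ↭
    (pending (first₁ S ∷ first₂ S ∷ []) seen (countPosEven as) ++ run (oddLeaf S) o (countOdd as)) ++ pairs c (pairCount seen as)
leaves-blocks S true  o t c [] = ↭-refl
leaves-blocks S false o t c [] = ↭-refl
leaves-blocks S seen o t c (zero ∷ as) = leaves-blocks S seen o (suc t) c as
leaves-blocks S seen o t c (suc x ∷ as) with isOdd (suc x)
... | true rewrite pairs-++ c (suc x / 2) (pairCount seen as) =
  insert-middle (oddLeaf S o) firsts odds _
    (insert-pairs (pairs c (suc x / 2)) (firsts ++ odds) _ (leaves-blocks S seen (suc o) t _ as))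
  where
  firsts = pending (first₁ S ∷ first₂ S ∷ []) seen (countPosEven as)
  odds = run (oddLeaf S) (suc o) (countOdd as)
... | false with seen
...   | true rewrite pairs-++ c (suc x / 2) (pairCount true as) =
  insert-pairs (pairs c (suc x / 2)) (run (oddLeaf S) o (countOdd as)) _ (leaves-blocks S true o (suc t) _ as)
...   | false rewrite pairs-++ c (pred (suc x / 2)) (pairCount true as) =
  prep (first₁ S) (prep (first₂ S) (insert-pairs (pairs c (pred (suc x / 2))) (run (oddLeaf S) o (countOdd as)) _
    (leaves-blocks S true o t _ as)))

-- Up to order, the child labels are first₁ + first₂, oddRoot + oddLeaf for the odd
-- children, and the regular labels (all leaf pairs cancel).
childLabels-blocks : ∀ S seen o t c as →
  childLabels (blocks S seen o t c as) ↭
    (pending (first₁ S ℤ.+ first₂ S ∷ []) seen (countPosEven as) ++ run (λ i → oddRoot S i ℤ.+ oddLeaf S i) o (countOdd as))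
      ++ run (regular S) t (regularCount seen as)
childLabels-blocks S true  o t c [] = ↭-refl
childLabels-blocks S false o t c [] = ↭-refl
childLabels-blocks S seen o t c (zero ∷ as) rewrite ℤP.+-identityʳ (regular S t) =
  insert-end (regular S t) _ _ (childLabels-blocks S seen o (suc t) c as)
childLabels-blocks S seen o t c (suc x ∷ as) with isOdd (suc x)
... | true rewrite sum-pairs c (suc x / 2) | ℤP.+-identityʳ (oddLeaf S o) =
  insert-middle (oddRoot S o ℤ.+ oddLeaf S o) (pending (first₁ S ℤ.+ first₂ S ∷ []) seen (countPosEven as)) _ _
    (childLabels-blocks S seen (suc o) t _ as)
... | false with seen
...   | true rewrite sum-pairs c (suc x / 2) | ℤP.+-identityʳ (regular S t) =
  insert-end (regular S t) _ _ (childLabels-blocks S true o (suc t) _ as)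
...   | false rewrite sum-pairs c (pred (suc x / 2)) | ℤP.+-identityʳ (first₂ S) | ℤP.+-identityˡ (first₁ S ℤ.+ first₂ S) =
  prep (first₁ S ℤ.+ first₂ S) (childLabels-blocks S true o t _ as)

-- The hand-placed labels of a scheme when there are l odd children: root-edge labels,
-- leaf labels, and the induced labels of the children concerned.
smallRoots : Scheme → ℕ → List ℤ
smallRoots S l = (+ 0 ∷ run (oddRoot S) 0 l) ++ (regular₁ S ∷ regular₂ S ∷ [])

smallLeaves : Scheme → ℕ → List ℤ
smallLeaves S l = first₁ S ∷ first₂ S ∷ run (oddLeaf S) 0 l

smallChildren : Scheme → ℕ → List ℤ
smallChildren S l =
  (first₁ S ℤ.+ first₂ S ∷ run (λ i → oddRoot S i ℤ.+ oddLeaf S i) 0 l) ++ (regular₁ S ∷ regular₂ S ∷ [])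

record Valid (S : Scheme) (l M : ℕ) : Set where
  field
    edges↭    : smallRoots S l ++ smallLeaves S l ↭ (+ 0 ∷ pairs 1 (small S)) ++ (+ M ∷ ℤ.- (+ M) ∷ [])
    vertices↭ : sumℤ (smallRoots S l) ∷ (smallChildren S l ++ smallLeaves S l) ↭
                pairs 1 (small S) ++ (+ M ∷ ℤ.- (+ M) ∷ + suc M ∷ ℤ.- (+ suc M) ∷ [])

pending-first : ∀ (xs : List ℤ) {k} → 1 ≤ k → pending xs false k ≡ xs
pending-first xs (s≤s _) = refl

-- 1, …, M splits into the hand-placed magnitudes, the regular root pairs, the leaf pairs and M.
pairs-split : ∀ s Y P → pairs 1 (suc (s + (Y + P))) ≡
  pairs 1 s ++ ((pairs (suc s) Y ++ pairs (suc s + Y) P) ++ (+ suc (s + (Y + P)) ∷ ℤ.- (+ suc (s + (Y + P))) ∷ []))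
pairs-split s Y P = begin
  pairs 1 (suc (s + (Y + P)))                                  ≡⟨ pairs-snoc 1 (s + (Y + P)) ⟩
  pairs 1 (s + (Y + P)) ++ ±top                                ≡⟨ cong (_++ ±top) (pairs-++ 1 s (Y + P)) ⟩
  (pairs 1 s ++ pairs (suc s) (Y + P)) ++ ±top                 ≡⟨ ListP.++-assoc (pairs 1 s) _ ±top ⟩
  pairs 1 s ++ (pairs (suc s) (Y + P) ++ ±top)                 ≡⟨ cong (λ ps → pairs 1 s ++ (ps ++ ±top)) (pairs-++ (suc s) Y P) ⟩
  pairs 1 s ++ ((pairs (suc s) Y ++ pairs (suc s + Y) P) ++ ±top) ∎
  where
  open ≡-Reasoning
  ±top = + suc (s + (Y + P)) ∷ ℤ.- (+ suc (s + (Y + P))) ∷ []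

interchange : ∀ (A P B P' : List ℤ) → (A ++ P) ++ (B ++ P') ↭ (A ++ B) ++ (P ++ P')
interchange A P B P' = begin
  (A ++ P) ++ (B ++ P') ≡⟨ ListP.++-assoc A P _ ⟩
  A ++ (P ++ (B ++ P')) ↭⟨ ↭P.++⁺ˡ A (↭P.shifts P B) ⟩
  A ++ (B ++ (P ++ P')) ≡⟨ ListP.++-assoc A B _ ⟨
  (A ++ B) ++ (P ++ P') ∎
  where open PermutationReasoning

move-last : ∀ (A Q P : List ℤ) → (A ++ Q) ++ P ↭ A ++ (P ++ Q)
move-last A Q P = ↭-trans (↭-reflexive (ListP.++-assoc A Q P)) (↭P.++⁺ˡ A (↭P.++-comm Q P))

scheme-graceful : ∀ S a Y M → 1 ≤ countPosEven a → regularCount false a ≡ suc (suc (Y + Y)) →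
  M ≡ suc (small S + (Y + pairCount false a)) → Valid S (countOdd a) M → SuperEdgeGraceful (RT a)
scheme-graceful S a Y M k≥1 regular-count refl valid =
  subst (SuperEdgeGraceful ∘ RT) (shape-blocks S false 0 0 c₀ a) (blocks-graceful M bs lab↭ vertex↭)
  where
  open Valid valid
  l  = countOdd a
  c₀ = suc (small S) + Y
  bs = blocks S false 0 0 c₀ a
  P₁ = pairs (suc (small S)) Y
  P₂ = pairs c₀ (pairCount false a)
  R  = smallRoots S l
  Lf = smallLeaves S l
  C  = smallChildren S l

  ±M   = + M ∷ ℤ.- (+ M) ∷ []
  ±M+1 = + suc M ∷ ℤ.- (+ suc M) ∷ []

  regulars = run (regular S) 0 (regularCount false a)
  split-regular : ∀ A → A ++ regulars ≡ (A ++ (regular₁ S ∷ regular₂ S ∷ [])) ++ P₁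
  split-regular A = trans (cong (λ n → A ++ run (regular S) 0 n) regular-count)
                          (trans (cong (A ++_) (run-regular S Y)) (sym (ListP.++-assoc A _ P₁)))

  roots↭ : roots bs ↭ R ++ P₁
  roots↭ = ↭-trans (roots-blocks S false 0 0 c₀ a)
    (↭-reflexive (trans (cong (λ p → (p ++ run (oddRoot S) 0 l) ++ regulars) (pending-first (+ 0 ∷ []) k≥1))
                        (split-regular (+ 0 ∷ run (oddRoot S) 0 l))))

  leaves↭ : leaves bs ↭ Lf ++ P₂
  leaves↭ = ↭-trans (leaves-blocks S false 0 0 c₀ a)
    (↭-reflexive (cong (λ p → (p ++ run (oddLeaf S) 0 l) ++ P₂) (pending-first (first₁ S ∷ first₂ S ∷ []) k≥1)))

  children↭ : childLabels bs ↭ C ++ P₁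
  children↭ = ↭-trans (childLabels-blocks S false 0 0 c₀ a)
    (↭-reflexive (trans (cong (λ p → (p ++ run oddSum 0 l) ++ regulars) (pending-first (first₁ S ℤ.+ first₂ S ∷ []) k≥1))
                        (split-regular (first₁ S ℤ.+ first₂ S ∷ run oddSum 0 l))))
    where oddSum = λ i → oddRoot S i ℤ.+ oddLeaf S i

  rootSum : sumℤ (roots bs) ≡ sumℤ R
  rootSum = begin
    sumℤ (roots bs)         ≡⟨ sumℤ-↭ roots↭ ⟩
    sumℤ (R ++ P₁)          ≡⟨ sumℤ-++ R P₁ ⟩
    sumℤ R ℤ.+ sumℤ P₁      ≡⟨ cong (λ z → sumℤ R ℤ.+ z) (sum-pairs (suc (small S)) Y) ⟩
    sumℤ R ℤ.+ + 0          ≡⟨ ℤP.+-identityʳ (sumℤ R) ⟩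
    sumℤ R ∎
    where open ≡-Reasoning

  lab↭ : lab bs ↭ + 0 ∷ pairs 1 M
  lab↭ = begin
    lab bs                                               ↭⟨ lab-↭ bs ⟩
    roots bs ++ leaves bs                                ↭⟨ ↭P.++⁺ roots↭ leaves↭ ⟩
    (R ++ P₁) ++ (Lf ++ P₂)                              ↭⟨ interchange R P₁ Lf P₂ ⟩
    (R ++ Lf) ++ (P₁ ++ P₂)                              ↭⟨ ↭P.++⁺ʳ (P₁ ++ P₂) edges↭ ⟩
    ((+ 0 ∷ pairs 1 (small S)) ++ ±M) ++ (P₁ ++ P₂)      ↭⟨ move-last (+ 0 ∷ pairs 1 (small S)) ±M (P₁ ++ P₂) ⟩
    + 0 ∷ pairs 1 (small S) ++ ((P₁ ++ P₂) ++ ±M)        ≡⟨ cong (+ 0 ∷_) (pairs-split (small S) Y (pairCount false a)) ⟨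
    + 0 ∷ pairs 1 M ∎
    where open PermutationReasoning

  vertex↭ : vertexLabels bs ↭ pairs 1 (suc M)
  vertex↭ = begin
    sumℤ (roots bs) ∷ (childLabels bs ++ leaves bs)     ≡⟨ cong (_∷ (childLabels bs ++ leaves bs)) rootSum ⟩
    sumℤ R ∷ (childLabels bs ++ leaves bs)              ↭⟨ prep (sumℤ R) (↭P.++⁺ children↭ leaves↭) ⟩
    sumℤ R ∷ ((C ++ P₁) ++ (Lf ++ P₂))                  ↭⟨ prep (sumℤ R) (interchange C P₁ Lf P₂) ⟩
    (sumℤ R ∷ (C ++ Lf)) ++ (P₁ ++ P₂)                  ↭⟨ ↭P.++⁺ʳ (P₁ ++ P₂) vertices↭ ⟩
    (pairs 1 (small S) ++ (±M ++ ±M+1)) ++ (P₁ ++ P₂)   ↭⟨ move-last (pairs 1 (small S)) (±M ++ ±M+1) (P₁ ++ P₂) ⟩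
    pairs 1 (small S) ++ ((P₁ ++ P₂) ++ (±M ++ ±M+1))   ≡⟨ cong (pairs 1 (small S) ++_) (ListP.++-assoc (P₁ ++ P₂) ±M ±M+1) ⟨
    pairs 1 (small S) ++ (((P₁ ++ P₂) ++ ±M) ++ ±M+1)   ≡⟨ ListP.++-assoc (pairs 1 (small S)) _ ±M+1 ⟨
    (pairs 1 (small S) ++ ((P₁ ++ P₂) ++ ±M)) ++ ±M+1   ≡⟨ cong (_++ ±M+1) (pairs-split (small S) Y (pairCount false a)) ⟨
    pairs 1 M ++ ±M+1                                    ≡⟨ pairs-snoc 1 M ⟨
    pairs 1 (suc M) ∎
    where open PermutationReasoning

-- Counting the regular labels: every zero entry and every positive even entry except the
-- first uses one.
regularCount-seen : ∀ as → regularCount true as ≡ countZero as + countPosEven as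
regularCount-seen []           = refl
regularCount-seen (zero ∷ as)  = cong suc (regularCount-seen as)
regularCount-seen (suc x ∷ as) with isOdd (suc x)
... | true  = regularCount-seen as
... | false = trans (cong suc (regularCount-seen as)) (sym (ℕP.+-suc _ _))

regularCount-unseen : ∀ as → 1 ≤ countPosEven as → suc (regularCount false as) ≡ countZero as + countPosEven as
regularCount-unseen (zero ∷ as)  k≥1 = cong suc (regularCount-unseen as k≥1)
regularCount-unseen (suc x ∷ as) k≥1 with isOdd (suc x)
... | true  = regularCount-unseen as k≥1
... | false = trans (cong suc (regularCount-seen as)) (sym (ℕP.+-suc _ _))

odd-form : ∀ j → j % 2 ≡ 1 → ∃ λ u → j ≡ suc (u + u)
odd-form j j-odd = j / 2 , trans (halves j) (cong (λ r → r + (j / 2 + j / 2)) j-odd)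

even-form : ∀ k → 2 ≤ k → k % 2 ≡ 0 → ∃ λ w → k ≡ suc w + suc w
even-form k k≥2 k-even = positive (k / 2) (trans (halves k) (cong (λ r → r + (k / 2 + k / 2)) k-even))
  where
  positive : ∀ v → k ≡ v + v → ∃ λ w → k ≡ suc w + suc w
  positive zero    k≡0 with () ← subst (2 ≤_) k≡0 k≥2
  positive (suc w) k≡  = w , k≡

-- With j odd and k ≥ 2 even, j + k - 1 = 2 + 2Y regular labels are needed.
regularCount-even : ∀ a → countZero a % 2 ≡ 1 → 2 ≤ countPosEven a → countPosEven a % 2 ≡ 0 →
  ∃ λ Y → regularCount false a ≡ suc (suc (Y + Y))
regularCount-even a j-odd k≥2 k-even with odd-form (countZero a) j-odd | even-form (countPosEven a) k≥2 k-even
... | u , j≡ | w , k≡ = u + w , ℕP.suc-injective (begin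
  suc (regularCount false a)           ≡⟨ regularCount-unseen a (ℕP.<⇒≤ k≥2) ⟩
  countZero a + countPosEven a         ≡⟨ cong₂ _+_ j≡ k≡ ⟩
  suc (u + u) + (suc w + suc w)        ≡⟨ rearrange u w ⟩
  suc (suc (suc ((u + w) + (u + w)))) ∎)
  where
  open ≡-Reasoning
  rearrange : ∀ u w → suc (u + u) + (suc w + suc w) ≡ suc (suc (suc ((u + w) + (u + w))))
  rearrange = solve 2 (λ u w → (con 1 :+ (u :+ u)) :+ ((con 1 :+ w) :+ (con 1 :+ w)) := con 3 :+ ((u :+ w) :+ (u :+ w))) refl
    where open +-*-Solver

move : ∀ (p xs : List ℤ) {v ys} → p ++ xs ++ v ∷ ys ↭ p ++ v ∷ xs ++ ys
move p xs = ↭P.++⁺ˡ p (↭P.shift _ xs _)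

scheme₁ : ℕ → Scheme
scheme₁ M = record
  { small = 2 ; first₁ = + 2 ; first₂ = -[1+ 0 ] ; regular₁ = -[1+ 1 ] ; regular₂ = ℤ.- (+ M)
  ; oddRoot = λ _ → + 1 ; oddLeaf = λ _ → + M }

valid₁ : ∀ X → Valid (scheme₁ (3 + X)) 1 (3 + X)
valid₁ X = record { edges↭ = edge-labels ; vertices↭ = vertex-labels }
  where
  open PermutationReasoning
  M = 3 + X
  m = + M
  m̄ = ℤ.- (+ M)
  edge-labels : + 0 ∷ + 1 ∷ -[1+ 1 ] ∷ m̄ ∷ + 2 ∷ -[1+ 0 ] ∷ m ∷ [] ↭
                + 0 ∷ + 1 ∷ -[1+ 0 ] ∷ + 2 ∷ -[1+ 1 ] ∷ m ∷ m̄ ∷ []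
  edge-labels = begin
    + 0 ∷ + 1 ∷ -[1+ 1 ] ∷ m̄ ∷ + 2 ∷ -[1+ 0 ] ∷ m ∷ []
      ↭⟨ move (+ 0 ∷ + 1 ∷ []) (-[1+ 1 ] ∷ m̄ ∷ + 2 ∷ []) ⟩
    + 0 ∷ + 1 ∷ -[1+ 0 ] ∷ -[1+ 1 ] ∷ m̄ ∷ + 2 ∷ m ∷ []
      ↭⟨ move (+ 0 ∷ + 1 ∷ -[1+ 0 ] ∷ []) (-[1+ 1 ] ∷ m̄ ∷ []) ⟩
    + 0 ∷ + 1 ∷ -[1+ 0 ] ∷ + 2 ∷ -[1+ 1 ] ∷ m̄ ∷ m ∷ []
      ↭⟨ move (+ 0 ∷ + 1 ∷ -[1+ 0 ] ∷ + 2 ∷ -[1+ 1 ] ∷ []) (m̄ ∷ []) ⟩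
    + 0 ∷ + 1 ∷ -[1+ 0 ] ∷ + 2 ∷ -[1+ 1 ] ∷ m ∷ m̄ ∷ [] ∎
  vertex-labels : -[1+ M ] ∷ + 1 ∷ + suc M ∷ -[1+ 1 ] ∷ m̄ ∷ + 2 ∷ -[1+ 0 ] ∷ m ∷ [] ↭
             + 1 ∷ -[1+ 0 ] ∷ + 2 ∷ -[1+ 1 ] ∷ m ∷ m̄ ∷ + suc M ∷ -[1+ M ] ∷ []
  vertex-labels = begin
    -[1+ M ] ∷ + 1 ∷ + suc M ∷ -[1+ 1 ] ∷ m̄ ∷ + 2 ∷ -[1+ 0 ] ∷ m ∷ []
      ↭⟨ move [] (-[1+ M ] ∷ []) ⟩
    + 1 ∷ -[1+ M ] ∷ + suc M ∷ -[1+ 1 ] ∷ m̄ ∷ + 2 ∷ -[1+ 0 ] ∷ m ∷ []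
      ↭⟨ move (+ 1 ∷ []) (-[1+ M ] ∷ + suc M ∷ -[1+ 1 ] ∷ m̄ ∷ + 2 ∷ []) ⟩
    + 1 ∷ -[1+ 0 ] ∷ -[1+ M ] ∷ + suc M ∷ -[1+ 1 ] ∷ m̄ ∷ + 2 ∷ m ∷ []
      ↭⟨ move (+ 1 ∷ -[1+ 0 ] ∷ []) (-[1+ M ] ∷ + suc M ∷ -[1+ 1 ] ∷ m̄ ∷ []) ⟩
    + 1 ∷ -[1+ 0 ] ∷ + 2 ∷ -[1+ M ] ∷ + suc M ∷ -[1+ 1 ] ∷ m̄ ∷ m ∷ []
      ↭⟨ move (+ 1 ∷ -[1+ 0 ] ∷ + 2 ∷ []) (-[1+ M ] ∷ + suc M ∷ []) ⟩
    + 1 ∷ -[1+ 0 ] ∷ + 2 ∷ -[1+ 1 ] ∷ -[1+ M ] ∷ + suc M ∷ m̄ ∷ m ∷ []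
      ↭⟨ ↭P.++⁺ˡ (+ 1 ∷ -[1+ 0 ] ∷ + 2 ∷ -[1+ 1 ] ∷ [])
           (↭P.++-comm (-[1+ M ] ∷ + suc M ∷ []) (m̄ ∷ m ∷ [])) ⟩
    + 1 ∷ -[1+ 0 ] ∷ + 2 ∷ -[1+ 1 ] ∷ m̄ ∷ m ∷ -[1+ M ] ∷ + suc M ∷ []
      ↭⟨ ↭P.++⁺ˡ (+ 1 ∷ -[1+ 0 ] ∷ + 2 ∷ -[1+ 1 ] ∷ []) (swap m̄ m (swap -[1+ M ] (+ suc M) ↭-refl)) ⟩
    + 1 ∷ -[1+ 0 ] ∷ + 2 ∷ -[1+ 1 ] ∷ m ∷ m̄ ∷ + suc M ∷ -[1+ M ] ∷ [] ∎

scheme₂ : ℕ → Scheme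
scheme₂ M = record
  { small = 3 ; first₁ = + 2 ; first₂ = -[1+ 2 ] ; regular₁ = -[1+ 1 ] ; regular₂ = + 3
  ; oddRoot = λ { zero → + 1 ; (suc _) → -[1+ 0 ] } ; oddLeaf = λ { zero → + M ; (suc _) → ℤ.- (+ M) } }

valid₂ : ∀ X → Valid (scheme₂ (4 + X)) 2 (4 + X)
valid₂ X = record { edges↭ = edge-labels ; vertices↭ = vertex-labels }
  where
  open PermutationReasoning
  M = 4 + X
  m = + M
  m̄ = ℤ.- (+ M)
  edge-labels : + 0 ∷ + 1 ∷ -[1+ 0 ] ∷ -[1+ 1 ] ∷ + 3 ∷ + 2 ∷ -[1+ 2 ] ∷ m ∷ m̄ ∷ [] ↭
          + 0 ∷ + 1 ∷ -[1+ 0 ] ∷ + 2 ∷ -[1+ 1 ] ∷ + 3 ∷ -[1+ 2 ] ∷ m ∷ m̄ ∷ []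
  edge-labels = move (+ 0 ∷ + 1 ∷ -[1+ 0 ] ∷ []) (-[1+ 1 ] ∷ + 3 ∷ [])
  vertex-labels : + 1 ∷ -[1+ 0 ] ∷ + suc M ∷ -[1+ M ] ∷ -[1+ 1 ] ∷ + 3 ∷ + 2 ∷ -[1+ 2 ] ∷ m ∷ m̄ ∷ [] ↭
             + 1 ∷ -[1+ 0 ] ∷ + 2 ∷ -[1+ 1 ] ∷ + 3 ∷ -[1+ 2 ] ∷ m ∷ m̄ ∷ + suc M ∷ -[1+ M ] ∷ []
  vertex-labels = begin
    + 1 ∷ -[1+ 0 ] ∷ + suc M ∷ -[1+ M ] ∷ -[1+ 1 ] ∷ + 3 ∷ + 2 ∷ -[1+ 2 ] ∷ m ∷ m̄ ∷ []
      ↭⟨ move (+ 1 ∷ -[1+ 0 ] ∷ []) (+ suc M ∷ -[1+ M ] ∷ -[1+ 1 ] ∷ + 3 ∷ []) ⟩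
    + 1 ∷ -[1+ 0 ] ∷ + 2 ∷ + suc M ∷ -[1+ M ] ∷ -[1+ 1 ] ∷ + 3 ∷ -[1+ 2 ] ∷ m ∷ m̄ ∷ []
      ↭⟨ move (+ 1 ∷ -[1+ 0 ] ∷ + 2 ∷ []) (+ suc M ∷ -[1+ M ] ∷ []) ⟩
    + 1 ∷ -[1+ 0 ] ∷ + 2 ∷ -[1+ 1 ] ∷ + suc M ∷ -[1+ M ] ∷ + 3 ∷ -[1+ 2 ] ∷ m ∷ m̄ ∷ []
      ↭⟨ ↭P.++⁺ˡ (+ 1 ∷ -[1+ 0 ] ∷ + 2 ∷ -[1+ 1 ] ∷ [])
           (↭P.++-comm (+ suc M ∷ -[1+ M ] ∷ []) (+ 3 ∷ -[1+ 2 ] ∷ m ∷ m̄ ∷ [])) ⟩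
    + 1 ∷ -[1+ 0 ] ∷ + 2 ∷ -[1+ 1 ] ∷ + 3 ∷ -[1+ 2 ] ∷ m ∷ m̄ ∷ + suc M ∷ -[1+ M ] ∷ [] ∎

lemma15 : (a : List ℕ) →
    countZero a % 2 ≡ 1 →
    2 ≤ countPosEven a → countPosEven a % 2 ≡ 0 →
    (countOdd a ≡ 1 ⊎ countOdd a ≡ 2) →
    SuperEdgeGraceful (RT a)
lemma15 a j-odd k≥2 k-even l≡1or2 with regularCount-even a j-odd k≥2 k-even | l≡1or2
... | Y , regulars | inj₁ l≡1 =
  scheme-graceful (scheme₁ M) a Y M (ℕP.<⇒≤ k≥2) regulars refl
    (subst (λ l → Valid (scheme₁ M) l M) (sym l≡1) (valid₁ _))
  where M = 3 + (Y + pairCount false a)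
... | Y , regulars | inj₂ l≡2 =
  scheme-graceful (scheme₂ M) a Y M (ℕP.<⇒≤ k≥2) regulars refl
    (subst (λ l → Valid (scheme₂ M) l M) (sym l≡2) (valid₂ _))
  where M = 4 + (Y + pairCount false a)
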